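{- Let $G$ be a $(P_2\cup P_4,\ \mathrm{HVN})$-free graph with $\omega=\omega(G)\ge 4$. Let $A$ be an induced complete $\omega$-partite subgraph of $G$ of maximum order, let $H=G-V(A)$, and let $k=\omega(H)$. Then $\chi(G)\le \max\{2k,\omega\}$.
   Context: All graphs are finite and simple. $P_2\cup P_4$ is the disjoint union of the paths on $2$ and $4$ vertices; the HVN is $K_5$ minus two edges incident to a common vertex; "$H$-free" means no induced subgraph isomorphic to $H$. A complete $\omega$-partite graph has its vertex set partitioned into $\omega$ nonempty stable sets (parts) with any two vertices in different parts adjacent. $\chi$ and $\omega$ denote chromatic number and clique number. -}

module Defs where

open import Data.Nat using (ℕ; zero; suc; _≤_; _≡ᵇ_)
open import Data.Bool using (Bool; true; false; _∨_; _∧_; not)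
open import Data.Fin using (Fin; toℕ)
open import Data.Fin.Subset using (Subset; _∈_; ∣_∣)
open import Data.Product using (Σ; _×_; ∃)
open import Relation.Binary.PropositionalEquality using (_≡_; _≢_)
open import Relation.Nullary using (¬_)
open import Function.Definitions using (Injective)
open import Function.Bundles using (_⇔_)

record Graph (n : ℕ) : Set where
  field
    adj    : Fin n → Fin n → Bool
    sym    : ∀ u v → adj u v ≡ adj v u
    irrefl : ∀ u → adj u u ≡ false
open Graph public

InducedIn : ∀ {m n} → (Fin m → Fin m → Bool) → Graph n → Set
InducedIn {m} {n} h G =
  Σ (Fin m → Fin n) λ f →
    Injective _≡_ _≡_ f × (∀ i j → i ≢ j → adj G (f i) (f j) ≡ h i j)

Free : ∀ {m n} → Graph n → (Fin m → Fin m → Bool) → Set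
Free G h = ¬ InducedIn h G

private
  p2p4E : ℕ → ℕ → Bool
  p2p4E 0 1 = true
  p2p4E 2 3 = true
  p2p4E 3 4 = true
  p2p4E 4 5 = true
  p2p4E _ _ = false

  hvnMissing : ℕ → ℕ → Bool
  hvnMissing 0 1 = true
  hvnMissing 0 2 = true
  hvnMissing _ _ = false

P2∪P4 : Fin 6 → Fin 6 → Bool
P2∪P4 i j = p2p4E (toℕ i) (toℕ j) ∨ p2p4E (toℕ j) (toℕ i)

-- HVN: K5 minus the two edges 01 and 02 (both incident to vertex 0).
HVN : Fin 5 → Fin 5 → Bool
HVN i j = not (toℕ i ≡ᵇ toℕ j) ∧ not (hvnMissing (toℕ i) (toℕ j) ∨ hvnMissing (toℕ j) (toℕ i))

CliqueIn : ∀ {n} → Graph n → Subset n → ℕ → Set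
CliqueIn {n} G T s =
  Σ (Fin s → Fin n) λ f →
    Injective _≡_ _≡_ f × (∀ i → f i ∈ T) × (∀ i j → i ≢ j → adj G (f i) (f j) ≡ true)

CliqueNumberOn : ∀ {n} → Graph n → Subset n → ℕ → Set
CliqueNumberOn G T w = CliqueIn G T w × (∀ s → CliqueIn G T s → s ≤ w)

CompleteMultipartiteOn : ∀ {n} → Graph n → ℕ → Subset n → Set
CompleteMultipartiteOn {n} G w S =
  Σ (Fin n → Fin w) λ part →
    (∀ j → ∃ λ v → v ∈ S × part v ≡ j) ×
    (∀ u v → u ∈ S → v ∈ S → u ≢ v → (adj G u v ≡ true ⇔ part u ≢ part v))

MaxCompleteMultipartite : ∀ {n} → Graph n → ℕ → Subset n → Set
MaxCompleteMultipartite G w S =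
  CompleteMultipartiteOn G w S × (∀ T → CompleteMultipartiteOn G w T → ∣ T ∣ ≤ ∣ S ∣)

Colorable : ∀ {n} → Graph n → ℕ → Set
Colorable {n} G m = Σ (Fin n → Fin m) λ c → ∀ u v → adj G u v ≡ true → c u ≢ c v

{-# OPTIONS --safe #-}
-- Let A = G[S] have parts 0, …, ω-1 and put h = ⌊ω/2⌋.  A vertex v outside S has neighbours in
-- at most one part of A: otherwise, as ω(G) = ω, v misses some part m entirely, HVN-freeness
-- and ω ≥ 4 force v to see all of A outside part m, and adding v to part m gives a larger
-- induced complete ω-partite graph.  So H splits into Y, the vertices with a neighbour in a
-- part ≥ h, which miss parts 0 and 1, and X, the rest, which miss parts h and h+1.  An edge
-- anticomplete to an induced P4 would give an induced P2 ∪ P4, so X and Y are P4-free, and in a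
-- P4-free graph every Grundy (First-Fit) colouring uses at most ω(H) ≤ k colours.  Colour A by
-- part index, X with h, …, h+k-1, and Y with 0, …, h-1 followed by h+k, …, 2k-1: X sees only
-- parts below h, Y sees only parts in [h, ω), and h+k ≥ ω whenever Y needs more than h colours.

module Submission where

open import Defs
open import Data.Nat using (ℕ; zero; suc; _+_; _≤_; _<_; _*_; _⊔_; ⌊_/2⌋; ⌈_/2⌉; z≤n; s≤s; z<s; _<?_; _≤?_)
open import Data.Nat.Properties as ℕP
  using ( ≤-refl; ≤-reflexive; ≤-trans; <-trans; <-≤-trans; ≤-<-trans; <⇒≤; <⇒≢; <⇒≱; ≮⇒≥; ≰⇒>; <-irrefl
        ; n≤1+n; n<1+n; m<n⇒m<1+n; m<1+n⇒m<n∨m≡n; m≤m+n; m<m+n; m≤m⊔n; m≤n⊔m; +-suc; +-identityʳ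
        ; +-monoˡ-≤; +-monoʳ-≤; +-monoˡ-<; +-monoʳ-<; +-cancelˡ-≡; +-cancelʳ-≡
        ; ⌊n/2⌋-mono; ⌊n/2⌋≤⌈n/2⌉; ⌊n/2⌋+⌈n/2⌉≡n )
open import Data.Fin.Subset using (Subset; ⊤; ∁; _∈_; _∉_; _⊂_; _∪_; ⁅_⁆; ∣_∣)
open import Data.Fin.Subset.Properties
  using (_∈?_; ∈⊤; x∈∁p⇒x∉p; x∉p⇒x∈∁p; x∈⁅x⁆; x∈⁅y⁆⇒x≡y; p⊆p∪q; x∈p∪q⁻; x∈p∪q⁺; p⊂q⇒∣p∣<∣q∣)

open import Data.Bool as Bool using (Bool; true; false)
open import Data.Empty using (⊥; ⊥-elim)
open import Data.Fin as Fin using (Fin; Fin′; zero; suc; toℕ; fromℕ<; inject)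
open import Data.Fin.Patterns using (0F; 1F; 2F; 3F; 4F; 5F)
open import Data.Fin.Properties
  using ( toℕ-injective; toℕ-fromℕ; toℕ-fromℕ<; toℕ-inject; toℕ<n; suc-injective; <-cmp; injective⇒≤
        ; all?; any?; ¬∀⟶∃¬; ¬∀⟶∃¬-smallest )
open import Data.Product using (∃; _×_; _,_; proj₁; proj₂)
open import Data.Sum using (_⊎_; inj₁; inj₂)
open import Data.Vec.Functional using (_∷_; []; updateAt)
open import Data.Vec.Functional.Properties using (updateAt-updates; updateAt-minimal)
open import Function using (_∘_)
open import Function.Bundles using (_⇔_; mk⇔; Equivalence)
open import Function.Definitions using (Injective)
open import Relation.Binary using (tri<; tri≈; tri>)
open import Relation.Nullary using (¬_; Dec; yes; no; ¬?)
open import Relation.Unary using (Decidable; _⊆_; _∩_)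
open import Relation.Nullary.Decidable using (_×-dec_; _→-dec_; toWitness)
import Relation.Binary.PropositionalEquality as ≡
open ≡ using (_≡_; _≢_; refl; cong; trans; subst)

leastFailure : ∀ {P : ℕ → Set} → Decidable P → ∀ {m} → ¬ P m → ∃ λ j → ¬ P j × (∀ {i} → i < j → P i)
leastFailure {P} P? {m} ¬Pm
  with ¬∀⟶∃¬-smallest (suc m) (P ∘ toℕ) (P? ∘ toℕ) (λ all → ¬Pm (subst P (toℕ-fromℕ m) (all (Fin.fromℕ m))))
... | j , ¬Pj , below =
  toℕ j , ¬Pj , λ i<j → subst P (trans (toℕ-inject _) (toℕ-fromℕ< i<j)) (below (fromℕ< i<j))

⌈n/2⌉≤1+⌊n/2⌋ : ∀ n → ⌈ n /2⌉ ≤ suc ⌊ n /2⌋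
⌈n/2⌉≤1+⌊n/2⌋ zero          = z≤n
⌈n/2⌉≤1+⌊n/2⌋ (suc zero)    = ≤-refl
⌈n/2⌉≤1+⌊n/2⌋ (suc (suc n)) = s≤s (⌈n/2⌉≤1+⌊n/2⌋ n)

fourthElement : ∀ {m} → 4 ≤ m → (a b c : Fin m) → ∃ λ d → d ≢ a × d ≢ b × d ≢ c
fourthElement {m} 4≤m a b c with any? (λ d → ¬? (d Fin.≟ a) ×-dec ¬? (d Fin.≟ b) ×-dec ¬? (d Fin.≟ c))
... | yes found = found
-- otherwise recording which of a, b, c each element equals injects Fin m into Fin 3
... | no none = ⊥-elim (<⇒≱ (n<1+n 3) (≤-trans 4≤m (injective⇒≤ (position-injective (cover _) (cover _)))))
  where
  Covered : Fin m → Set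
  Covered d = d ≡ a ⊎ d ≡ b ⊎ d ≡ c

  cover : ∀ d → Covered d
  cover d with d Fin.≟ a | d Fin.≟ b | d Fin.≟ c
  ... | yes d≡a | _       | _       = inj₁ d≡a
  ... | no _    | yes d≡b | _       = inj₂ (inj₁ d≡b)
  ... | no _    | no _    | yes d≡c = inj₂ (inj₂ d≡c)
  ... | no d≢a  | no d≢b  | no d≢c  = ⊥-elim (none (d , d≢a , d≢b , d≢c))

  position : ∀ {d} → Covered d → Fin 3
  position (inj₁ _)        = 0F
  position (inj₂ (inj₁ _)) = 1F
  position (inj₂ (inj₂ _)) = 2F

  position-injective : ∀ {d d′} (p : Covered d) (q : Covered d′) → position p ≡ position q → d ≡ d′
  position-injective (inj₁ d≡a)        (inj₁ d′≡a)        _ = trans d≡a (≡.sym d′≡a)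
  position-injective (inj₂ (inj₁ d≡b)) (inj₂ (inj₁ d′≡b)) _ = trans d≡b (≡.sym d′≡b)
  position-injective (inj₂ (inj₂ d≡c)) (inj₂ (inj₂ d′≡c)) _ = trans d≡c (≡.sym d′≡c)
  position-injective (inj₁ _)        (inj₂ (inj₁ _)) ()
  position-injective (inj₁ _)        (inj₂ (inj₂ _)) ()
  position-injective (inj₂ (inj₁ _)) (inj₁ _)        ()
  position-injective (inj₂ (inj₁ _)) (inj₂ (inj₂ _)) ()
  position-injective (inj₂ (inj₂ _)) (inj₁ _)        ()
  position-injective (inj₂ (inj₂ _)) (inj₂ (inj₁ _)) ()

NoFalseTwins : ∀ {m} → (Fin m → Fin m → Bool) → Set
NoFalseTwins h = ∀ i j → i ≢ j → h i j ≡ false → ∃ λ l → l ≢ i × l ≢ j × h i l ≢ h j l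

noFalseTwins? : ∀ {m} (h : Fin m → Fin m → Bool) → Dec (NoFalseTwins h)
noFalseTwins? h = all? λ i → all? λ j → ¬? (i Fin.≟ j) →-dec (h i j Bool.≟ false) →-dec
  any? λ l → ¬? (l Fin.≟ i) ×-dec ¬? (l Fin.≟ j) ×-dec ¬? (h i l Bool.≟ h j l)

Symmetric : ∀ {m} → (Fin m → Fin m → Bool) → Set
Symmetric h = ∀ i j → h i j ≡ h j i

symmetric? : ∀ {m} (h : Fin m → Fin m → Bool) → Dec (Symmetric h)
symmetric? h = all? λ i → all? λ j → h i j Bool.≟ h j i

P2∪P4-symmetric : Symmetric P2∪P4
P2∪P4-symmetric = toWitness {a? = symmetric? P2∪P4} _

P2∪P4-noFalseTwins : NoFalseTwins P2∪P4
P2∪P4-noFalseTwins = toWitness {a? = noFalseTwins? P2∪P4} _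

HVN-symmetric : Symmetric HVN
HVN-symmetric = toWitness {a? = symmetric? HVN} _

HVN-noFalseTwins : NoFalseTwins HVN
HVN-noFalseTwins = toWitness {a? = noFalseTwins? HVN} _

module Adjacency {n} (G : Graph n) where

  infix 4 _~_ _≁_ _~?_

  _~_ : Fin n → Fin n → Set
  u ~ v = adj G u v ≡ true

  _≁_ : Fin n → Fin n → Set
  u ≁ v = adj G u v ≡ false

  _~?_ : ∀ u v → Dec (u ~ v)
  u ~? v = adj G u v Bool.≟ true

  ~-sym : ∀ {u v} → u ~ v → v ~ u
  ~-sym {u} {v} u~v = trans (sym G v u) u~v

  ≁-sym : ∀ {u v} → u ≁ v → v ≁ u
  ≁-sym {u} {v} u≁v = trans (sym G v u) u≁v

  ¬~⇒≁ : ∀ {u v} → ¬ u ~ v → u ≁ v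
  ¬~⇒≁ {u} {v} u≁v with adj G u v
  ... | true = ⊥-elim (u≁v refl)
  ... | false = refl

  ~⇒¬≁ : ∀ {u v} → u ~ v → ¬ u ≁ v
  ~⇒¬≁ u~v u≁v with () ← trans (≡.sym u~v) u≁v

  ~⇒≢ : ∀ {u v} → u ~ v → u ≢ v
  ~⇒≢ {u} u~u refl = ~⇒¬≁ u~u (irrefl G u)

  IsClique : ∀ {s} → (Fin s → Fin n) → Set
  IsClique f = ∀ {i j} → i ≢ j → f i ~ f j

  ∷-isClique : ∀ {s y} {f : Fin s → Fin n} → (∀ i → y ~ f i) → IsClique f → IsClique (y ∷ f)
  ∷-isClique y~f f-clique {0F}    {0F}    0≢0 = ⊥-elim (0≢0 refl)
  ∷-isClique y~f f-clique {0F}    {suc j} _   = y~f j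
  ∷-isClique y~f f-clique {suc i} {0F}    _   = ~-sym (y~f i)
  ∷-isClique y~f f-clique {suc i} {suc j} i≢j = f-clique (i≢j ∘ cong suc)

  isClique⇒injective : ∀ {s} {f : Fin s → Fin n} → IsClique f → Injective _≡_ _≡_ f
  isClique⇒injective {f = f} f-clique {i} {j} fi≡fj with i Fin.≟ j
  ... | yes i≡j = i≡j
  ... | no i≢j = ⊥-elim (~⇒≢ (f-clique i≢j) fi≡fj)

  colourable : ∀ {m} (c : Fin n → ℕ) → (∀ v → c v < m) → (∀ {u v} → u ~ v → c u ≢ c v) → Colorable G m
  colourable c c<m proper = (λ v → fromℕ< (c<m v)) , λ u v u~v same →
    proper u~v (trans (≡.sym (toℕ-fromℕ< (c<m u))) (trans (cong toℕ same) (toℕ-fromℕ< (c<m v))))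

  isClique⇒CliqueIn : ∀ {s} {T : Subset n} (f : Fin s → Fin n) → (∀ i → f i ∈ T) → IsClique f →
    CliqueIn G T s
  isClique⇒CliqueIn f f∈T f-clique = f , isClique⇒injective f-clique , f∈T , λ _ _ → f-clique

  LowerTriangle : ∀ {m} → (Fin m → Fin m → Bool) → (Fin m → Fin n) → Set
  LowerTriangle h f = ∀ j (i : Fin′ j) → adj G (f (inject i)) (f j) ≡ h (inject i) j

  inducedFromLowerTriangle : ∀ {m} (h : Fin m → Fin m → Bool) → Symmetric h → NoFalseTwins h →
    (f : Fin m → Fin n) → LowerTriangle h f → InducedIn h G
  inducedFromLowerTriangle h h-sym twins f lower = f , f-injective , f-induced
    where
    below : ∀ {i j} → i Fin.< j → adj G (f i) (f j) ≡ h i j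
    below {i} {j} i<j = subst (λ x → adj G (f x) (f j) ≡ h x j) inject-fromℕ< (lower j (fromℕ< i<j))
      where
      inject-fromℕ< : inject (fromℕ< i<j) ≡ i
      inject-fromℕ< = toℕ-injective (trans (toℕ-inject _) (toℕ-fromℕ< i<j))

    f-induced : ∀ i j → i ≢ j → adj G (f i) (f j) ≡ h i j
    f-induced i j i≢j with <-cmp i j
    ... | tri< i<j _ _ = below i<j
    ... | tri≈ _ i≡j _ = ⊥-elim (i≢j i≡j)
    ... | tri> _ _ j<i = trans (sym G (f i) (f j)) (trans (below j<i) (h-sym j i))

    sameImage⇒nonadjacent : ∀ {i j} → i ≢ j → f i ≡ f j → h i j ≡ false
    sameImage⇒nonadjacent {i} i≢j fi≡fj =
      trans (≡.sym (f-induced _ _ i≢j)) (subst (λ x → adj G (f i) x ≡ false) fi≡fj (irrefl G (f i)))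

    sameImage⇒twins : ∀ {i j l} → l ≢ i → l ≢ j → f i ≡ f j → h i l ≡ h j l
    sameImage⇒twins {l = l} l≢i l≢j fi≡fj =
      trans (≡.sym (f-induced _ _ (l≢i ∘ ≡.sym)))
            (trans (cong (λ x → adj G x (f l)) fi≡fj) (f-induced _ _ (l≢j ∘ ≡.sym)))

    f-injective : Injective _≡_ _≡_ f
    f-injective {i} {j} fi≡fj with i Fin.≟ j
    ... | yes i≡j = i≡j
    ... | no i≢j with twins i j i≢j (sameImage⇒nonadjacent i≢j fi≡fj)
    ...   | l , l≢i , l≢j , differ = ⊥-elim (differ (sameImage⇒twins l≢i l≢j fi≡fj))

  record IsP4 (a b c d : Fin n) : Set where
    constructor isP4
    field
      a~b : a ~ b
      b~c : b ~ c
      c~d : c ~ d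
      a≁c : a ≁ c
      a≁d : a ≁ d
      b≁d : b ≁ d

  P4Free : (Fin n → Set) → Set
  P4Free Z = ∀ {a b c d} → Z a → Z b → Z c → Z d → ¬ IsP4 a b c d

  P4Free⇒chord : ∀ {Z a b c d} → P4Free Z → Z a → Z b → Z c → Z d →
    a ~ b → b ~ c → c ~ d → a ≁ d → b ≁ d → a ~ c
  P4Free⇒chord P4-free Za Zb Zc Zd a~b b~c c~d a≁d b≁d with _ ~? _
  ... | yes a~c = a~c
  ... | no a≁c = ⊥-elim (P4-free Za Zb Zc Zd (isP4 a~b b~c c~d (¬~⇒≁ a≁c) a≁d b≁d))

  anticompleteEdge⇒P4Free : Free G P2∪P4 → ∀ {p q Z} → p ~ q → (∀ {z} → Z z → p ≁ z × q ≁ z) → P4Free Z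
  anticompleteEdge⇒P4Free P2∪P4-free {p} {q} p~q far {a} {b} {c} {d} Za Zb Zc Zd
    (isP4 a~b b~c c~d a≁c a≁d b≁d) =
    P2∪P4-free (inducedFromLowerTriangle P2∪P4 P2∪P4-symmetric P2∪P4-noFalseTwins
      (p ∷ q ∷ a ∷ b ∷ c ∷ d ∷ []) lower)
    where
    lower : LowerTriangle P2∪P4 (p ∷ q ∷ a ∷ b ∷ c ∷ d ∷ [])
    lower 1F 0F = p~q
    lower 2F 0F = proj₁ (far Za)
    lower 2F 1F = proj₂ (far Za)
    lower 3F 0F = proj₁ (far Zb)
    lower 3F 1F = proj₂ (far Zb)
    lower 3F 2F = a~b
    lower 4F 0F = proj₁ (far Zc)
    lower 4F 1F = proj₂ (far Zc)
    lower 4F 2F = a≁c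
    lower 4F 3F = b~c
    lower 5F 0F = proj₁ (far Zd)
    lower 5F 1F = proj₂ (far Zd)
    lower 5F 2F = a≁d
    lower 5F 3F = b≁d
    lower 5F 4F = c~d

  HVNFree⇒noHalfAdjacentK4 : Free G HVN → ∀ {v a b c d} → a ~ b → a ~ c → a ~ d → b ~ c → b ~ d → c ~ d →
    v ~ a → v ~ b → v ≁ c → v ≁ d → ⊥
  HVNFree⇒noHalfAdjacentK4 HVN-free {v} {a} {b} {c} {d} a~b a~c a~d b~c b~d c~d v~a v~b v≁c v≁d =
    HVN-free (inducedFromLowerTriangle HVN HVN-symmetric HVN-noFalseTwins (v ∷ c ∷ d ∷ a ∷ b ∷ []) lower)
    where
    lower : LowerTriangle HVN (v ∷ c ∷ d ∷ a ∷ b ∷ [])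
    lower 1F 0F = v≁c
    lower 2F 0F = v≁d
    lower 2F 1F = c~d
    lower 3F 0F = v~a
    lower 3F 1F = ~-sym a~c
    lower 3F 2F = ~-sym a~d
    lower 4F 0F = v~b
    lower 4F 1F = ~-sym b~c
    lower 4F 2F = ~-sym b~d
    lower 4F 3F = a~b

module Grundy {n} (G : Graph n) where

  open Adjacency G

  Proper : (Fin n → Set) → (Fin n → ℕ) → Set
  Proper Z c = ∀ {u v} → Z u → Z v → u ~ v → c u ≢ c v

  IsGrundy : (Fin n → Set) → (Fin n → ℕ) → Set
  IsGrundy Z c = ∀ {v} → Z v → ∀ {j} → j < c v → ∃ λ u → Z u × u ~ v × c u ≡ j

  P4Free-⊆ : ∀ {Z Y} → Z ⊆ Y → P4Free Y → P4Free Z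
  P4Free-⊆ Z⊆Y Y-P4-free Za Zb Zc Zd = Y-P4-free (Z⊆Y Za) (Z⊆Y Zb) (Z⊆Y Zc) (Z⊆Y Zd)

  module _ {Z} (P4-free : P4Free Z) {c} (proper : Proper Z c) (grundy : IsGrundy Z c) where

    commonNeighbourOfColour : ∀ {s j w} (f : Fin s → Fin n) → (∀ i → Z (f i)) → (∀ i → j < c (f i)) →
      IsClique f → Z w → j < c w → ∃ λ y → Z y × c y ≡ j × (∀ i → y ~ f i)
    commonNeighbourOfColour {zero} f _ _ _ Zw j<cw with grundy Zw j<cw
    ... | u , Zu , _ , cu≡j = u , Zu , cu≡j , λ ()
    commonNeighbourOfColour {suc s} f Zf j<cf f-clique Zw j<cw
      with commonNeighbourOfColour (f ∘ suc) (Zf ∘ suc) (j<cf ∘ suc) (λ i≢j → f-clique (i≢j ∘ suc-injective))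
             Zw j<cw
    ... | y , Zy , cy≡j , y~rest with y ~? f 0F
    ...   | yes y~x = y , Zy , cy≡j , λ { 0F → y~x ; (suc i) → y~rest i }
    ...   | no y≁x with grundy (Zf 0F) (j<cf 0F)
    ...     | z , Zz , z~x , cz≡j = z , Zz , cz≡j , z~f
      where
      z≁y : z ≁ y
      z≁y = ¬~⇒≁ λ z~y → proper Zz Zy z~y (trans cz≡j (≡.sym cy≡j))

      -- z, f 0, f (suc i), y would otherwise induce a P4
      z~f : ∀ i → z ~ f i
      z~f 0F = z~x
      z~f (suc i) = P4Free⇒chord P4-free Zz (Zf 0F) (Zf (suc i)) Zy
        z~x (f-clique (λ ())) (~-sym (y~rest i)) z≁y (≁-sym (¬~⇒≁ y≁x))

    cliqueOfColoursFrom : ∀ {v} → Z v → ∀ d j → j + d ≡ c v →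
      ∃ λ (f : Fin (suc d) → Fin n) → (∀ i → Z (f i)) × (∀ i → j ≤ c (f i)) × IsClique f
    cliqueOfColoursFrom {v} Zv zero j j+0≡cv =
      v ∷ [] , (λ { 0F → Zv }) , (λ { 0F → ≤-reflexive (trans (≡.sym (+-identityʳ j)) j+0≡cv) }) ,
      ∷-isClique (λ ()) (λ { {()} })
    cliqueOfColoursFrom Zv (suc d) j j+1+d≡cv
      with cliqueOfColoursFrom Zv d (suc j) (trans (≡.sym (+-suc j d)) j+1+d≡cv)
    ... | f , Zf , j<cf , f-clique
      with commonNeighbourOfColour f Zf j<cf f-clique Zv (subst (j <_) j+1+d≡cv (m<m+n j z<s))
    ... | y , Zy , cy≡j , y~f =
      y ∷ f , (λ { 0F → Zy ; (suc i) → Zf i }) ,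
      (λ { 0F → ≤-reflexive (≡.sym cy≡j) ; (suc i) → <⇒≤ (j<cf i) }) , ∷-isClique y~f f-clique

    grundyClique : ∀ {v} → Z v → ∃ λ (f : Fin (suc (c v)) → Fin n) → (∀ i → Z (f i)) × IsClique f
    grundyClique {v} Zv with cliqueOfColoursFrom Zv (c v) 0 refl
    ... | f , Zf , _ , f-clique = f , Zf , f-clique

  module FirstFit {Y : Fin n → Set} (Y? : Decidable Y) (P4-free : P4Free Y) {k}
    (cliqueBound : ∀ {s} (f : Fin s → Fin n) → (∀ i → Y (f i)) → IsClique f → s ≤ k) where

    Stage : ℕ → Fin n → Set
    Stage i = Y ∩ λ x → toℕ x < i

    Colouring : (Fin n → Set) → Set
    Colouring Z = ∃ λ c → Proper Z c × IsGrundy Z c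

    grundyColour<k : ∀ {Z} → Z ⊆ Y → ((c , proper , grundy) : Colouring Z) → ∀ {v} → Z v → c v < k
    grundyColour<k Z⊆Y (c , proper , grundy) Zv with grundyClique (P4Free-⊆ Z⊆Y P4-free) proper grundy Zv
    ... | f , Zf , f-clique = cliqueBound f (Z⊆Y ∘ Zf) f-clique

    firstFitStep : ∀ {i} → i < n → Colouring (Stage i) → Colouring (Stage (suc i))
    firstFitStep {i} i<n colouring@(c , proper , grundy) = c′ , proper′ , grundy′
      where
      w : Fin n
      w = fromℕ< i<n

      Taken : ℕ → Set
      Taken j = ∃ λ u → Stage i u × u ~ w × c u ≡ j

      taken? : Decidable Taken
      taken? j = any? λ u → (Y? u ×-dec toℕ u <? i) ×-dec u ~? w ×-dec c u ℕP.≟ j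

      -- k itself is never taken, since earlier colours are < k
      free : ∃ λ col → ¬ Taken col × (∀ {j} → j < col → Taken j)
      free = leastFailure taken? λ (u , Su , _ , cu≡k) → <-irrefl cu≡k (grundyColour<k proj₁ colouring Su)

      c′ : Fin n → ℕ
      c′ = updateAt c w λ _ → proj₁ free

      Stage-suc : ∀ {x} → Stage (suc i) x → Stage i x ⊎ x ≡ w
      Stage-suc (Yx , x<1+i) with m<1+n⇒m<n∨m≡n x<1+i
      ... | inj₁ x<i = inj₁ (Yx , x<i)
      ... | inj₂ x≡i = inj₂ (toℕ-injective (trans x≡i (≡.sym (toℕ-fromℕ< i<n))))

      Stage-widen : ∀ {x} → Stage i x → Stage (suc i) x
      Stage-widen (Yx , x<i) = Yx , m<n⇒m<1+n x<i

      c′-old : ∀ {x} → Stage i x → c′ x ≡ c x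
      c′-old {x} (_ , x<i) = updateAt-minimal x w c λ { refl → <-irrefl (toℕ-fromℕ< i<n) x<i }

      c′-new : c′ w ≡ proj₁ free
      c′-new = updateAt-updates w c

      new≢old : ∀ {v} → Stage i v → v ~ w → c′ w ≢ c′ v
      new≢old Sv v~w c′w≡c′v =
        proj₁ (proj₂ free) (_ , Sv , v~w , trans (≡.sym (c′-old Sv)) (trans (≡.sym c′w≡c′v) c′-new))

      proper′ : Proper (Stage (suc i)) c′
      proper′ Su Sv u~v with Stage-suc Su | Stage-suc Sv
      ... | inj₁ Su | inj₁ Sv =
        λ c′u≡c′v → proper Su Sv u~v (trans (≡.sym (c′-old Su)) (trans c′u≡c′v (c′-old Sv)))
      ... | inj₁ Su | inj₂ refl = new≢old Su u~v ∘ ≡.sym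
      ... | inj₂ refl | inj₁ Sv = new≢old Sv (~-sym u~v)
      ... | inj₂ refl | inj₂ refl = ⊥-elim (~⇒≢ u~v refl)

      grundy′ : IsGrundy (Stage (suc i)) c′
      grundy′ Sv {j} j<c′v with Stage-suc Sv
      ... | inj₁ Sv with grundy Sv (subst (j <_) (c′-old Sv) j<c′v)
      ...   | u , Su , u~v , cu≡j = u , Stage-widen Su , u~v , trans (c′-old Su) cu≡j
      grundy′ Sv {j} j<c′v | inj₂ refl with proj₂ (proj₂ free) (subst (j <_) c′-new j<c′v)
      ...   | u , Su , u~w , cu≡j = u , Stage-widen Su , u~w , trans (c′-old Su) cu≡j

    firstFit : ∀ i → i ≤ n → Colouring (Stage i)
    firstFit zero _ = (λ _ → 0) , (λ { (_ , ()) }) , λ { (_ , ()) }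
    firstFit (suc i) i<n = firstFitStep i<n (firstFit i (<⇒≤ i<n))

    cographColouring : ∃ λ c → (∀ {v} → Y v → c v < k) × Proper Y c
    cographColouring with firstFit n ≤-refl
    ... | colouring@(c , proper , _) =
      c , (λ Yv → grundyColour<k proj₁ colouring (Yv , toℕ<n _)) ,
      λ Yu Yv → proper (Yu , toℕ<n _) (Yv , toℕ<n _)

module CompleteMultipartite {n} (G : Graph n) {ω} {S : Subset n} (S-multipartite : CompleteMultipartiteOn G ω S)
  where

  open Adjacency G

  part : Fin n → Fin ω
  part = proj₁ S-multipartite

  representative : Fin ω → Fin n
  representative p = proj₁ (proj₁ (proj₂ S-multipartite) p)

  representative∈S : ∀ p → representative p ∈ S
  representative∈S p = proj₁ (proj₂ (proj₁ (proj₂ S-multipartite) p))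

  part-representative : ∀ p → part (representative p) ≡ p
  part-representative p = proj₂ (proj₂ (proj₁ (proj₂ S-multipartite) p))

  private
    adjacency : ∀ {u v} → u ∈ S → v ∈ S → u ≢ v → (u ~ v ⇔ part u ≢ part v)
    adjacency = proj₂ (proj₂ S-multipartite) _ _

  part≢⇒~ : ∀ {u v} → u ∈ S → v ∈ S → part u ≢ part v → u ~ v
  part≢⇒~ uS vS pu≢pv = Equivalence.from (adjacency uS vS (pu≢pv ∘ cong part)) pu≢pv

  part≡⇒≁ : ∀ {u v} → u ∈ S → v ∈ S → part u ≡ part v → u ≁ v
  part≡⇒≁ {u} {v} uS vS pu≡pv with u Fin.≟ v
  ... | yes refl = irrefl G u
  ... | no u≢v = ¬~⇒≁ λ u~v → Equivalence.to (adjacency uS vS u≢v) u~v pu≡pv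

  extend : ∀ {v} → v ∉ S → (m : Fin ω) → (∀ {u} → u ∈ S → (v ~ u ⇔ part u ≢ m)) →
    CompleteMultipartiteOn G ω (S ∪ ⁅ v ⁆)
  extend {v} v∉S m v-adjacency = part′ , nonempty , adjacency′
    where
    part′ : Fin n → Fin ω
    part′ = updateAt part v λ _ → m

    part′-old : ∀ {u} → u ∈ S → part′ u ≡ part u
    part′-old {u} uS = updateAt-minimal u v part λ { refl → v∉S uS }

    part′-new : part′ v ≡ m
    part′-new = updateAt-updates v part

    nonempty : ∀ p → ∃ λ u → u ∈ S ∪ ⁅ v ⁆ × part′ u ≡ p
    nonempty p = representative p , x∈p∪q⁺ (inj₁ (representative∈S p)) ,
                 trans (part′-old (representative∈S p)) (part-representative p)

    v-adjacency′ : ∀ {u} → u ∈ S → (v ~ u ⇔ part′ v ≢ part′ u)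
    v-adjacency′ uS rewrite part′-old uS | part′-new =
      mk⇔ (λ v~u m≡pu → Equivalence.to (v-adjacency uS) v~u (≡.sym m≡pu))
          (λ m≢pu → Equivalence.from (v-adjacency uS) (m≢pu ∘ ≡.sym))

    ∈S∪v : ∀ {u} → u ∈ S ∪ ⁅ v ⁆ → u ∈ S ⊎ u ≡ v
    ∈S∪v u∈ with x∈p∪q⁻ S ⁅ v ⁆ u∈
    ... | inj₁ uS = inj₁ uS
    ... | inj₂ u∈v = inj₂ (x∈⁅y⁆⇒x≡y v u∈v)

    adjacency′ : ∀ u w → u ∈ S ∪ ⁅ v ⁆ → w ∈ S ∪ ⁅ v ⁆ → u ≢ w → (u ~ w ⇔ part′ u ≢ part′ w)
    adjacency′ u w u∈ w∈ u≢w with ∈S∪v u∈ | ∈S∪v w∈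
    ... | inj₁ uS | inj₁ wS rewrite part′-old uS | part′-old wS = adjacency uS wS u≢w
    ... | inj₂ refl | inj₁ wS = v-adjacency′ wS
    ... | inj₁ uS | inj₂ refl =
      mk⇔ (λ u~v → Equivalence.to (v-adjacency′ uS) (~-sym u~v) ∘ ≡.sym)
          (λ pu≢pv → ~-sym (Equivalence.from (v-adjacency′ uS) (pu≢pv ∘ ≡.sym)))
    ... | inj₂ refl | inj₂ refl = ⊥-elim (u≢w refl)

  Touches : Fin n → Fin ω → Set
  Touches v p = ∃ λ u → u ∈ S × part u ≡ p × v ~ u

  touches? : ∀ v → Decidable (Touches v)
  touches? v p = any? λ u → u ∈? S ×-dec part u Fin.≟ p ×-dec v ~? u

  touchesAll⇒clique : ∀ {v} → (∀ p → Touches v p) → CliqueIn G ⊤ (suc ω)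
  touchesAll⇒clique {v} touchesAll =
    isClique⇒CliqueIn (v ∷ neighbour) (λ _ → ∈⊤) (∷-isClique v~neighbour neighbour-clique)
    where
    neighbour : Fin ω → Fin n
    neighbour p = proj₁ (touchesAll p)

    v~neighbour : ∀ p → v ~ neighbour p
    v~neighbour p = proj₂ (proj₂ (proj₂ (touchesAll p)))

    neighbour-part : ∀ p → part (neighbour p) ≡ p
    neighbour-part p = proj₁ (proj₂ (proj₂ (touchesAll p)))

    neighbour-clique : IsClique neighbour
    neighbour-clique {p} {q} p≢q = part≢⇒~ (proj₁ (proj₂ (touchesAll p))) (proj₁ (proj₂ (touchesAll q)))
      λ same → p≢q (trans (≡.sym (neighbour-part p)) (trans same (neighbour-part q)))

  Misses : Fin n → Fin ω → Set
  Misses v m = ∀ {u} → u ∈ S → part u ≡ m → v ≁ u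

  untouchedPart : (∀ s → CliqueIn G ⊤ s → s ≤ ω) → ∀ v → ∃ (Misses v)
  untouchedPart ω-bound v with all? (touches? v)
  ... | yes touchesAll = ⊥-elim (<-irrefl refl (ω-bound (suc ω) (touchesAll⇒clique touchesAll)))
  ... | no ¬touchesAll with ¬∀⟶∃¬ ω (Touches v) (touches? v) ¬touchesAll
  ...   | m , ¬touches = m , λ uS pu≡m → ¬~⇒≁ λ v~u → ¬touches (_ , uS , pu≡m , v~u)

  seen⇒part≢ : ∀ {v m x} → Misses v m → x ∈ S → v ~ x → part x ≢ m
  seen⇒part≢ v-misses-m xS v~x px≡m = ~⇒¬≁ v~x (v-misses-m xS px≡m)

  module _ (HVN-free : Free G HVN) {v m} (v-misses-m : Misses v m) where

    -- otherwise x, y, u and a vertex of part m span a K4 of which v sees exactly x and y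
    seesThirdPart : ∀ {x y u} → x ∈ S → y ∈ S → u ∈ S → v ~ x → v ~ y →
      part x ≢ part y → part u ≢ part x → part u ≢ part y → part u ≢ m → v ~ u
    seesThirdPart xS yS uS v~x v~y x≢y u≢x u≢y u≢m with v ~? _
    ... | yes v~u = v~u
    ... | no v≁u = ⊥-elim (HVNFree⇒noHalfAdjacentK4 HVN-free
          (part≢⇒~ xS yS x≢y) (part≢⇒~ xS uS (u≢x ∘ ≡.sym))
          (part≢⇒~ xS cS (≢m⇒≢c (seen⇒part≢ v-misses-m xS v~x)))
          (part≢⇒~ yS uS (u≢y ∘ ≡.sym)) (part≢⇒~ yS cS (≢m⇒≢c (seen⇒part≢ v-misses-m yS v~y)))
          (part≢⇒~ uS cS (≢m⇒≢c u≢m))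
          v~x v~y (¬~⇒≁ v≁u) (v-misses-m cS (part-representative m)))
      where
      cS : representative m ∈ S
      cS = representative∈S m

      ≢m⇒≢c : ∀ {z} → part z ≢ m → part z ≢ part (representative m)
      ≢m⇒≢c pz≢m pz≡pc = pz≢m (trans pz≡pc (part-representative m))

    module _ (4≤ω : 4 ≤ ω) {a b} (aS : a ∈ S) (bS : b ∈ S) (v~a : v ~ a) (v~b : v ~ b)
             (a≢b : part a ≢ part b) where

      seenInFourthPart : ∃ λ e → e ∈ S × part e ≢ part a × part e ≢ part b × v ~ e
      seenInFourthPart with fourthElement 4≤ω (part a) (part b) m
      ... | p , p≢a , p≢b , p≢m =
        representative p , representative∈S p , e≢a , e≢b ,
        seesThirdPart aS bS (representative∈S p) v~a v~b a≢b e≢a e≢b e≢m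
        where
        e≢a : part (representative p) ≢ part a
        e≢a = p≢a ∘ trans (≡.sym (part-representative p))
        e≢b : part (representative p) ≢ part b
        e≢b = p≢b ∘ trans (≡.sym (part-representative p))
        e≢m : part (representative p) ≢ m
        e≢m = p≢m ∘ trans (≡.sym (part-representative p))

      seesAllOtherParts : ∀ {u} → u ∈ S → part u ≢ m → v ~ u
      seesAllOtherParts {u} uS u≢m with seenInFourthPart | part u Fin.≟ part a | part u Fin.≟ part b
      ... | e , eS , e≢a , e≢b , v~e | yes u≡a | _ =
        seesThirdPart bS eS uS v~b v~e (e≢b ∘ ≡.sym) (a≢b ∘ trans (≡.sym u≡a))
          (e≢a ∘ ≡.sym ∘ trans (≡.sym u≡a)) u≢m
      ... | e , eS , e≢a , e≢b , v~e | no u≢a | yes u≡b =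
        seesThirdPart aS eS uS v~a v~e (e≢a ∘ ≡.sym) u≢a (e≢b ∘ ≡.sym ∘ trans (≡.sym u≡b)) u≢m
      ... | _ | no u≢a | no u≢b = seesThirdPart aS bS uS v~a v~b a≢b u≢a u≢b u≢m

  touchesOnePart : 4 ≤ ω → (∀ s → CliqueIn G ⊤ s → s ≤ ω) → Free G HVN →
    (∀ T → CompleteMultipartiteOn G ω T → ∣ T ∣ ≤ ∣ S ∣) →
    ∀ {v a b} → v ∉ S → a ∈ S → b ∈ S → v ~ a → v ~ b → part a ≡ part b
  touchesOnePart 4≤ω ω-bound HVN-free maximum {v} {a} {b} v∉S aS bS v~a v~b
    with part a Fin.≟ part b | untouchedPart ω-bound v
  ... | yes same | _ = same
  ... | no a≢b | m , v-misses-m =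
    ⊥-elim (<⇒≱ (p⊂q⇒∣p∣<∣q∣ S⊂S∪v) (maximum _ (extend v∉S m λ uS →
      mk⇔ (seen⇒part≢ v-misses-m uS) (seesAllOtherParts HVN-free v-misses-m 4≤ω aS bS v~a v~b a≢b uS))))
    where
    S⊂S∪v : S ⊂ S ∪ ⁅ v ⁆
    S⊂S∪v = p⊆p∪q ⁅ v ⁆ , v , x∈p∪q⁺ (inj₂ (x∈⁅x⁆ v)) , v∉S

module LowHighSplit {n} (G : Graph n) {ω} (4≤ω : 4 ≤ ω) (ω-bound : ∀ s → CliqueIn G ⊤ s → s ≤ ω)
  (P2∪P4-free : Free G P2∪P4) (HVN-free : Free G HVN) {S} (S-maximum : MaxCompleteMultipartite G ω S)
  {k} (k-bound : ∀ s → CliqueIn G (∁ S) s → s ≤ k) where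

  open Adjacency G
  open Grundy G
  open CompleteMultipartite G (proj₁ S-maximum)

  h : ℕ
  h = ⌊ ω /2⌋

  2≤h : 2 ≤ h
  2≤h = ⌊n/2⌋-mono 4≤ω

  h+h≤ω : h + h ≤ ω
  h+h≤ω = ≤-trans (+-monoʳ-≤ h (⌊n/2⌋≤⌈n/2⌉ ω)) (≤-reflexive (⌊n/2⌋+⌈n/2⌉≡n ω))

  ω≤1+h+h : ω ≤ suc (h + h)
  ω≤1+h+h = ≤-trans (≤-reflexive (≡.sym (⌊n/2⌋+⌈n/2⌉≡n ω)))
                    (≤-trans (+-monoʳ-≤ h (⌈n/2⌉≤1+⌊n/2⌋ ω)) (≤-reflexive (+-suc h h)))

  1+h<ω : suc h < ω
  1+h<ω = ≤-trans (+-monoˡ-≤ h 2≤h) h+h≤ω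

  vertexOfPart : ∀ {j} → j < ω → Fin n
  vertexOfPart j<ω = representative (fromℕ< j<ω)

  vertexOfPart∈S : ∀ {j} (j<ω : j < ω) → vertexOfPart j<ω ∈ S
  vertexOfPart∈S j<ω = representative∈S (fromℕ< j<ω)

  toℕ-part-vertexOfPart : ∀ {j} (j<ω : j < ω) → toℕ (part (vertexOfPart j<ω)) ≡ j
  toℕ-part-vertexOfPart j<ω = trans (cong toℕ (part-representative (fromℕ< j<ω))) (toℕ-fromℕ< j<ω)

  vertexOfPart-~ : ∀ {i j} (i<ω : i < ω) (j<ω : j < ω) → i ≢ j → vertexOfPart i<ω ~ vertexOfPart j<ω
  vertexOfPart-~ i<ω j<ω i≢j = part≢⇒~ (vertexOfPart∈S i<ω) (vertexOfPart∈S j<ω) λ same →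
    i≢j (trans (≡.sym (toℕ-part-vertexOfPart i<ω)) (trans (cong toℕ same) (toℕ-part-vertexOfPart j<ω)))

  High : Fin n → Set
  High u = h ≤ toℕ (part u)

  HasHighNeighbour : Fin n → Set
  HasHighNeighbour v = ∃ λ u → u ∈ S × High u × v ~ u

  hasHighNeighbour? : Decidable HasHighNeighbour
  hasHighNeighbour? v = any? λ u → u ∈? S ×-dec h ≤? toℕ (part u) ×-dec v ~? u

  X Y : Fin n → Set
  X v = v ∈ ∁ S × ¬ HasHighNeighbour v
  Y v = v ∈ ∁ S × HasHighNeighbour v

  high≁X : ∀ {x u} → X x → u ∈ S → High u → u ≁ x
  high≁X (_ , noHighNeighbour) uS high = ≁-sym (¬~⇒≁ λ x~u → noHighNeighbour (_ , uS , high , x~u))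

  low≁Y : ∀ {y u} → Y y → u ∈ S → toℕ (part u) < h → u ≁ y
  low≁Y (y∈∁S , w , wS , high , y~w) uS low = ≁-sym (¬~⇒≁ λ y~u → <⇒≱ low
    (subst (λ p → h ≤ toℕ p)
      (touchesOnePart 4≤ω ω-bound HVN-free (proj₂ S-maximum) (x∈∁p⇒x∉p y∈∁S) wS uS y~w y~u) high))

  X-P4Free : P4Free X
  X-P4Free = anticompleteEdge⇒P4Free P2∪P4-free (vertexOfPart-~ h<ω 1+h<ω (<⇒≢ (n<1+n h))) λ Xz →
    high≁X Xz (vertexOfPart∈S h<ω) (≤-reflexive (≡.sym (toℕ-part-vertexOfPart h<ω))) ,
    high≁X Xz (vertexOfPart∈S 1+h<ω) (subst (h ≤_) (≡.sym (toℕ-part-vertexOfPart 1+h<ω)) (n≤1+n h))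
    where
    h<ω : h < ω
    h<ω = <-trans (n<1+n h) 1+h<ω

  Y-P4Free : P4Free Y
  Y-P4Free = anticompleteEdge⇒P4Free P2∪P4-free (vertexOfPart-~ 0<ω 1<ω λ ()) λ Yz →
    low≁Y Yz (vertexOfPart∈S 0<ω) (subst (_< h) (≡.sym (toℕ-part-vertexOfPart 0<ω)) (≤-trans (s≤s z≤n) 2≤h)) ,
    low≁Y Yz (vertexOfPart∈S 1<ω) (subst (_< h) (≡.sym (toℕ-part-vertexOfPart 1<ω)) 2≤h)
    where
    0<ω : 0 < ω
    0<ω = ≤-trans (s≤s z≤n) 4≤ω
    1<ω : 1 < ω
    1<ω = ≤-trans (s≤s (s≤s z≤n)) 4≤ω

  cliqueBound : ∀ {Z : Fin n → Set} → Z ⊆ (_∈ ∁ S) →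
    ∀ {s} (f : Fin s → Fin n) → (∀ i → Z (f i)) → IsClique f → s ≤ k
  cliqueBound Z⊆H f Zf f-clique = k-bound _ (isClique⇒CliqueIn f (Z⊆H ∘ Zf) f-clique)

  X? : Decidable X
  X? v = v ∈? ∁ S ×-dec ¬? (hasHighNeighbour? v)

  Y? : Decidable Y
  Y? v = v ∈? ∁ S ×-dec hasHighNeighbour? v

  open FirstFit X? X-P4Free (cliqueBound {X} proj₁) using () renaming (cographColouring to X-colouring)
  open FirstFit Y? Y-P4Free (cliqueBound {Y} proj₁) using () renaming (cographColouring to Y-colouring)

  cX cY : Fin n → ℕ
  cX = proj₁ X-colouring
  cY = proj₁ Y-colouring

  cX<k : ∀ {v} → X v → cX v < k
  cX<k = proj₁ (proj₂ X-colouring)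

  cY<k : ∀ {v} → Y v → cY v < k
  cY<k = proj₁ (proj₂ Y-colouring)

  cX-proper : Proper X cX
  cX-proper = proj₂ (proj₂ X-colouring)

  cY-proper : Proper Y cY
  cY-proper = proj₂ (proj₂ Y-colouring)

  liftY : ℕ → ℕ
  liftY c with c <? h
  ... | yes _ = c
  ... | no _ = c + k

  liftY-injective : ∀ {a b} → liftY a ≡ liftY b → a ≡ b
  liftY-injective {a} {b} eq with a <? h | b <? h
  ... | yes _   | yes _   = eq
  ... | no _    | no _    = +-cancelʳ-≡ k a b eq
  ... | yes a<h | no b≮h  = ⊥-elim (<⇒≱ a<h (subst (h ≤_) (≡.sym eq) (≤-trans (≮⇒≥ b≮h) (m≤m+n b k))))
  ... | no a≮h  | yes b<h = ⊥-elim (<⇒≱ b<h (subst (h ≤_) eq (≤-trans (≮⇒≥ a≮h) (m≤m+n a k))))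

  -- a colour ≥ h occurs only when h < k, and then h + k ≥ 2h + 1 ≥ ω
  liftY-avoids : ∀ {c} → c < k → liftY c < h ⊎ (ω ≤ liftY c × h + k ≤ liftY c)
  liftY-avoids {c} c<k with c <? h
  ... | yes c<h = inj₁ c<h
  ... | no c≮h = inj₂ (≤-trans ω≤1+h+h (≤-trans 1+h+h≤h+k h+k≤c+k) , h+k≤c+k)
    where
    h+k≤c+k : h + k ≤ c + k
    h+k≤c+k = +-monoˡ-≤ k (≮⇒≥ c≮h)

    1+h+h≤h+k : suc (h + h) ≤ h + k
    1+h+h≤h+k = subst (_≤ h + k) (+-suc h h) (+-monoʳ-≤ h (≤-<-trans (≮⇒≥ c≮h) c<k))

  data Class (v : Fin n) : Set where
    inS : v ∈ S → Class v
    inX : X v → Class v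
    inY : Y v → Class v

  classify : ∀ v → Class v
  classify v with v ∈? S | hasHighNeighbour? v
  ... | yes vS  | _             = inS vS
  ... | no v∉S | no noHigh     = inX (x∉p⇒x∈∁p v∉S , noHigh)
  ... | no v∉S | yes highNbr   = inY (x∉p⇒x∈∁p v∉S , highNbr)

  colourOf : ∀ {v} → Class v → ℕ
  colourOf {v} (inS _) = toℕ (part v)
  colourOf {v} (inX _) = h + cX v
  colourOf {v} (inY _) = liftY (cY v)

  S-X-distinct : ∀ {u v} → u ∈ S → X v → u ~ v → toℕ (part u) ≢ h + cX v
  S-X-distinct uS Xv u~v same with h ≤? toℕ (part _)
  ... | yes high = ~⇒¬≁ u~v (high≁X Xv uS high)
  ... | no low = low (subst (h ≤_) (≡.sym same) (m≤m+n h _))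

  S-Y-distinct : ∀ {u v} → u ∈ S → Y v → u ~ v → toℕ (part u) ≢ liftY (cY v)
  S-Y-distinct {u} uS Yv u~v same with toℕ (part u) <? h | liftY-avoids (cY<k Yv)
  ... | yes low | _ = ~⇒¬≁ u~v (low≁Y Yv uS low)
  ... | no high | inj₁ small = high (subst (_< h) (≡.sym same) small)
  ... | no _ | inj₂ (big , _) = <⇒≱ (toℕ<n (part u)) (subst (ω ≤_) (≡.sym same) big)

  X-Y-distinct : ∀ {u v} → X u → Y v → h + cX u ≢ liftY (cY v)
  X-Y-distinct Xu Yv same with liftY-avoids (cY<k Yv)
  ... | inj₁ small = <⇒≱ small (subst (h ≤_) same (m≤m+n h _))
  ... | inj₂ (_ , big) = <⇒≱ (+-monoʳ-< h (cX<k Xu)) (subst (h + k ≤_) (≡.sym same) big)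

  colourOf-proper : ∀ {u v} (p : Class u) (q : Class v) → u ~ v → colourOf p ≢ colourOf q
  colourOf-proper (inS uS) (inS vS) u~v = ~⇒¬≁ u~v ∘ part≡⇒≁ uS vS ∘ toℕ-injective
  colourOf-proper (inS uS) (inX Xv) u~v = S-X-distinct uS Xv u~v
  colourOf-proper (inS uS) (inY Yv) u~v = S-Y-distinct uS Yv u~v
  colourOf-proper (inX Xu) (inS vS) u~v = S-X-distinct vS Xu (~-sym u~v) ∘ ≡.sym
  colourOf-proper (inX Xu) (inX Xv) u~v = cX-proper Xu Xv u~v ∘ +-cancelˡ-≡ h _ _
  colourOf-proper (inX Xu) (inY Yv) _   = X-Y-distinct Xu Yv
  colourOf-proper (inY Yu) (inS vS) u~v = S-Y-distinct vS Yu (~-sym u~v) ∘ ≡.sym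
  colourOf-proper (inY Yu) (inX Xv) _   = X-Y-distinct Xv Yu ∘ ≡.sym
  colourOf-proper (inY Yu) (inY Yv) u~v = cY-proper Yu Yv u~v ∘ liftY-injective

  k+k≤N : k + k ≤ 2 * k ⊔ ω
  k+k≤N = subst (_≤ 2 * k ⊔ ω) (cong (k +_) (+-identityʳ k)) (m≤m⊔n (2 * k) ω)

  ω≤N : ω ≤ 2 * k ⊔ ω
  ω≤N = m≤n⊔m (2 * k) ω

  h+k≤N : h + k ≤ 2 * k ⊔ ω
  h+k≤N with k ≤? h
  ... | yes k≤h = ≤-trans (+-monoʳ-≤ h k≤h) (≤-trans h+h≤ω ω≤N)
  ... | no k≰h = ≤-trans (+-monoˡ-≤ k (<⇒≤ (≰⇒> k≰h))) k+k≤N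

  colourOf<N : ∀ {v} (p : Class v) → colourOf p < 2 * k ⊔ ω
  colourOf<N {v} (inS _) = <-≤-trans (toℕ<n (part v)) ω≤N
  colourOf<N (inX Xv) = <-≤-trans (+-monoʳ-< h (cX<k Xv)) h+k≤N
  colourOf<N {v} (inY Yv) with cY v <? h
  ... | yes c<h = <-≤-trans c<h (≤-trans (≤-trans (m≤m+n h h) h+h≤ω) ω≤N)
  ... | no _ = <-≤-trans (+-monoˡ-< k (cY<k Yv)) k+k≤N

lemma3p3 : ∀ {n} (G : Graph n) (ω : ℕ) → 4 ≤ ω → CliqueNumberOn G ⊤ ω →
    Free G P2∪P4 → Free G HVN →
    (S : Subset n) → MaxCompleteMultipartite G ω S →
    (k : ℕ) → CliqueNumberOn G (∁ S) k →
    Colorable G ((2 * k) ⊔ ω)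
lemma3p3 G ω 4≤ω (_ , ω-bound) P2∪P4-free HVN-free S S-maximum k (_ , k-bound) =
  colourable (colourOf ∘ classify) (colourOf<N ∘ classify)
    λ {u} {v} → colourOf-proper (classify u) (classify v)
  where
  open Adjacency G
  open LowHighSplit G 4≤ω ω-bound P2∪P4-free HVN-free S-maximum k-bound
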